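{- Let $\mathbb{K}=(G,M,I)$ be a formal context and let $\mathbb{S}=[H,N]$ be a Boolean subcontext of dimension $k$ of $\mathbb{K}$. If $H=G$ or $N=M$, then $\phi_1(\mathbb{S})=\phi_2(\mathbb{S})$.
   Context: All sets are finite. A formal context $\mathbb{K}=(G,M,I)$ has finite $G$, $M$ and $I\subseteq G\times M$; for $A\subseteq G$, $A'=\{m\in M\mid\forall g\in A:(g,m)\in I\}$, for $B\subseteq M$, $B'=\{g\in G\mid\forall m\in B:(g,m)\in I\}$. Concepts are pairs $(A,B)$ with $A'=B$, $B'=A$, forming the concept lattice $\underline{\mathfrak{B}}(\mathbb{K})$ (ordered by extent inclusion). For $H\subseteq G$, $N\subseteq M$, $[H,N]=(H,N,I\cap(H\times N))$ with concepts computed w.r.t. its own incidence. $[H,N]$ is a Boolean subcontext of dimension $k$ if its concept lattice is isomorphic to the concept lattice $\mathfrak{B}(k)$ of the contranominal scale $(\{1,\dots,k\},\{1,\dots,k\},\ne)$. For a concept $(A,B)$ of $\mathbb{S}=[H,N]$, $\phi_1(A,B)=(A'',A')$ and $\phi_2(A,B)=(B',B'')$ with derivations in $\mathbb{K}$, and $\phi_i(\mathbb{S})$ denotes the suborder $\{\phi_i(C)\mid C\text{ a concept of }\mathbb{S}\}$ of $\underline{\mathfrak{B}}(\mathbb{K})$. -}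

module Defs where

open import Data.Nat using (ℕ; zero; suc)
open import Data.Bool using (Bool; true; false; _∧_; _∨_; not)
open import Data.Fin using (Fin; zero; suc; _≟_)
open import Data.Fin.Subset using (Subset; ⊤; _⊆_)
open import Data.Vec using (lookup; tabulate)
open import Data.Product using (Σ; _×_; _,_; ∃)
open import Relation.Nullary.Decidable using (⌊_⌋)
open import Relation.Binary.PropositionalEquality using (_≡_)

allFin : ∀ {n} → (Fin n → Bool) → Bool
allFin {zero}  f = true
allFin {suc n} f = f zero ∧ allFin (λ i → f (suc i))

-- A finite formal context: objects Fin g, attributes Fin m, incidence I.
Incidence : ℕ → ℕ → Set
Incidence g m = Fin g → Fin m → Bool

-- Derivation operators of the subcontext [H,N] = (H, N, I ∩ (H × N)),
-- with subsets of H (resp. N) represented as subsets of Fin g (resp. Fin m).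
up : ∀ {g m} → Incidence g m → Subset g → Subset m → Subset g → Subset m
up I H N A = tabulate λ j → lookup N j ∧ allFin (λ i → not (lookup A i) ∨ I i j)

down : ∀ {g m} → Incidence g m → Subset g → Subset m → Subset m → Subset g
down I H N B = tabulate λ i → lookup H i ∧ allFin (λ j → not (lookup B j) ∨ I i j)

upK : ∀ {g m} → Incidence g m → Subset g → Subset m
upK I = up I ⊤ ⊤

downK : ∀ {g m} → Incidence g m → Subset m → Subset g
downK I = down I ⊤ ⊤

record Concept {g m : ℕ} (I : Incidence g m) (H : Subset g) (N : Subset m) : Set where
  constructor concept
  field
    extent : Subset g
    intent : Subset m
    up-ext   : up I H N extent ≡ intent
    down-int : down I H N intent ≡ extent
open Concept public

_≤C_ : ∀ {g m} {I : Incidence g m} {H N} → Concept I H N → Concept I H N → Set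
c ≤C d = extent c ⊆ extent d

-- Order isomorphism of concept lattices (concepts are identified by their extent).
record LatticeIso {g m g' m'} (I : Incidence g m) (H : Subset g) (N : Subset m)
                  (J : Incidence g' m') (H' : Subset g') (N' : Subset m') : Set where
  field
    to   : Concept I H N → Concept J H' N'
    from : Concept J H' N' → Concept I H N
    from-to : ∀ c → extent (from (to c)) ≡ extent c
    to-from : ∀ d → extent (to (from d)) ≡ extent d
    to-mono   : ∀ c d → c ≤C d → to c ≤C to d
    from-mono : ∀ c d → c ≤C d → from c ≤C from d

contranominal : (k : ℕ) → Incidence k k
contranominal k i j = not ⌊ i ≟ j ⌋

IsBooleanSubcontext : ∀ {g m} → Incidence g m → Subset g → Subset m → ℕ → Set
IsBooleanSubcontext I H N k = LatticeIso I H N (contranominal k) ⊤ ⊤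

φ₁ : ∀ {g m} {I : Incidence g m} {H N} → Concept I H N → Subset g × Subset m
φ₁ {I = I} c = downK I (upK I (extent c)) , upK I (extent c)

φ₂ : ∀ {g m} {I : Incidence g m} {H N} → Concept I H N → Subset g × Subset m
φ₂ {I = I} c = downK I (intent c) , upK I (downK I (intent c))

-- In any context the derivations form a Galois connection, so B''' = B'.
-- If H = G, every extent of [H,N] is a derivation B' taken in K, hence
-- φ₁(A,B) = (B''', B'') = (B', B'') = φ₂(A,B); dually if N = M.
module Submission where

open import Defs
open import Data.Nat using (ℕ; zero; suc)
open import Data.Bool using (Bool; true; false; T; not; _∧_; _∨_)
open import Data.Fin using (Fin; zero; suc)
open import Data.Fin.Subset using (Subset; ⊤)
open import Data.Vec using (lookup; tabulate)
open import Data.Vec.Properties using (lookup∘tabulate; lookup-replicate; tabulate∘lookup; tabulate-cong)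
open import Data.Product using (_×_; ∃; _,_)
open import Data.Sum using (_⊎_; inj₁; inj₂)
open import Data.Unit using (tt)
open import Function using (flip; case_of_)
open import Relation.Binary.PropositionalEquality

private
  variable
    n g m : ℕ

T-ext : ∀ {x y : Bool} → (T x → T y) → (T y → T x) → x ≡ y
T-ext {false} {false} _   _   = refl
T-ext {false} {true}  _   y⇒x = case y⇒x tt of λ ()
T-ext {true}  {false} x⇒y _   = case x⇒y tt of λ ()
T-ext {true}  {true}  _   _   = refl

T-allFin⁺ : (f : Fin n → Bool) → (∀ i → T (f i)) → T (allFin f)
T-allFin⁺ {zero}  f all = tt
T-allFin⁺ {suc n} f all with f zero | all zero
... | true | _ = T-allFin⁺ (λ i → f (suc i)) (λ i → all (suc i))

T-allFin⁻ : (f : Fin n → Bool) → T (allFin f) → ∀ i → T (f i)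
T-allFin⁻ f all zero with f zero
... | true = tt
T-allFin⁻ f all (suc i) with f zero
... | true = T-allFin⁻ (λ i → f (suc i)) all i

T-implies⁺ : ∀ x y → (T x → T y) → T (not x ∨ y)
T-implies⁺ false y _   = tt
T-implies⁺ true  y x⇒y = x⇒y tt

T-implies⁻ : ∀ x y → T (not x ∨ y) → T x → T y
T-implies⁻ true y y-holds _ = y-holds

subset-ext : {X Y : Subset n} → (∀ i → T (lookup X i) → T (lookup Y i)) →
             (∀ i → T (lookup Y i) → T (lookup X i)) → X ≡ Y
subset-ext {X = X} {Y} X⊆Y Y⊆X = begin
  X                    ≡⟨ tabulate∘lookup X ⟨
  tabulate (lookup X)  ≡⟨ tabulate-cong (λ i → T-ext (X⊆Y i) (Y⊆X i)) ⟩
  tabulate (lookup Y)  ≡⟨ tabulate∘lookup Y ⟩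
  Y                    ∎
  where open ≡-Reasoning

lookup-downK : ∀ (I : Incidence g m) B i →
               lookup (downK I B) i ≡ allFin (λ j → not (lookup B j) ∨ I i j)
lookup-downK I B i = trans (lookup∘tabulate _ i) (cong (_∧ _) (lookup-replicate i true))

∈-downK⁺ : ∀ (I : Incidence g m) B i → (∀ j → T (lookup B j) → T (I i j)) → T (lookup (downK I B) i)
∈-downK⁺ I B i h =
  subst T (sym (lookup-downK I B i)) (T-allFin⁺ _ (λ j → T-implies⁺ (lookup B j) (I i j) (h j)))

∈-downK⁻ : ∀ (I : Incidence g m) B i → T (lookup (downK I B) i) → ∀ j → T (lookup B j) → T (I i j)
∈-downK⁻ I B i i∈B' j =
  T-implies⁻ (lookup B j) (I i j) (T-allFin⁻ _ (subst T (lookup-downK I B i) i∈B') j)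

downK-upK-downK : ∀ (I : Incidence g m) B → downK I (upK I (downK I B)) ≡ downK I B
downK-upK-downK I B = subset-ext
  (λ i i∈B''' → ∈-downK⁺ I B i λ j j∈B → ∈-downK⁻ I (upK I (downK I B)) i i∈B''' j (B⊆B'' j j∈B))
  (λ i i∈B' → ∈-downK⁺ I (upK I (downK I B)) i λ j j∈B'' → ∈-downK⁻ (flip I) (downK I B) j j∈B'' i i∈B')
  where
    B⊆B'' : ∀ j → T (lookup B j) → T (lookup (upK I (downK I B)) j)
    B⊆B'' j j∈B = ∈-downK⁺ (flip I) (downK I B) j λ i i∈B' → ∈-downK⁻ I B i i∈B' j j∈B

-- upK I is definitionally downK (flip I).
upK-downK-upK : ∀ (I : Incidence g m) A → upK I (downK I (upK I A)) ≡ upK I A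
upK-downK-upK I = downK-upK-downK (flip I)

φ₁≡φ₂-objects : ∀ (I : Incidence g m) N (c : Concept I ⊤ N) → φ₁ c ≡ φ₂ c
φ₁≡φ₂-objects I N (concept A B _ refl) = cong (_, upK I A) (downK-upK-downK I B)

φ₁≡φ₂-attributes : ∀ (I : Incidence g m) H (c : Concept I H ⊤) → φ₁ c ≡ φ₂ c
φ₁≡φ₂-attributes I H (concept A B refl _) = cong (downK I B ,_) (sym (upK-downK-upK I A))

φ₁≡φ₂ : ∀ (I : Incidence g m) H N → H ≡ ⊤ ⊎ N ≡ ⊤ → (c : Concept I H N) → φ₁ c ≡ φ₂ c
φ₁≡φ₂ I H N (inj₁ refl) = φ₁≡φ₂-objects I N
φ₁≡φ₂ I H N (inj₂ refl) = φ₁≡φ₂-attributes I H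

proposition1 : ∀ {g m : ℕ} (I : Incidence g m) (H : Subset g) (N : Subset m) (k : ℕ) →
    IsBooleanSubcontext I H N k →
    (H ≡ ⊤ ⊎ N ≡ ⊤) →
    ((c : Concept I H N) → ∃ λ (d : Concept I H N) → φ₁ c ≡ φ₂ d)
    × ((d : Concept I H N) → ∃ λ (c : Concept I H N) → φ₂ d ≡ φ₁ c)
proposition1 I H N k _ G⊎M =
  (λ c → c , φ₁≡φ₂ I H N G⊎M c) , (λ d → d , sym (φ₁≡φ₂ I H N G⊎M d))
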